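{- Let $p\ge 3$ and $n\ge 2$. Let $H_1,H_2$ be the subgraphs of $H_p^n$ induced by the configurations whose largest disc $d_n$ lies on peg $1$, respectively peg $2$. Let $\partial_v(H_1,H_2)=\{u\in V(H_1):\exists v\in V(H_2),\,(u,v)\in E(H_p^n)\}$, define $\partial_v(H_2,H_1)$ symmetrically, and let $\partial_e(H_1,H_2)$ be the set of edges of $H_p^n$ with one endpoint in $H_1$ and the other in $H_2$. Then for each vertex $s\in V(H_1)$ the MSF problem $\pi_{tran}(s)=\big(\partial_v(H_1,H_2),\partial_v(H_2,H_1),\sigma\equiv\delta\equiv|V(H_1)|/|\partial_v(H_1,H_2)|\big)$ can be solved by an MSF $f_{tran}^s$ such that the total $\sum_{s\in V(H_1)}f_{tran}^s$ has congestion at most $\frac{|V(H_1)|\,|V(H_2)|}{|\partial_e(H_1,H_2)|\,|V(H_p^n)|}$, where the congestion of $g\colon A\to\mathbb{R}_{\ge0}$ means $\frac{1}{|V(H_p^n)|}\max_{a\in A}g(a)$.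
   Context: The Tower of Hanoi puzzle has $n$ discs $d_1,\dots,d_n$ ($d_i$ larger than $d_j$ when $i>j$) and pegs $[p]$; configurations are functions $\tau\colon\{d_1,\dots,d_n\}\to[p]$, and $H_p^n$ has the configurations as vertices, two being adjacent iff they differ by a single legal move (moving a top disc onto a peg whose discs are all larger). $A$ is the set of arcs $(u,v),(v,u)$ for each edge $\{u,v\}$ of $H_p^n$, and $N(v)$ the neighbourhood of $v$. An MSF problem is a tuple $(S,T,\sigma,\delta)$ with $S,T\subseteq V$, $\sigma\colon S\to\mathbb{R}$, $\delta\colon T\to\mathbb{R}$; an MSF solving it is $f\colon A\to\mathbb{R}_{\ge0}$ such that, writing $\mathrm{net}(u)=\sum_{v\in N(u)}(f(u,v)-f(v,u))$: $\mathrm{net}(u)=\sigma(u)$ for $u\in S\setminus T$; $-\mathrm{net}(u)=\delta(u)$ for $u\in T\setminus S$; $\mathrm{net}(u)=\sigma(u)-\delta(u)$ for $u\in S\cap T$; and $\mathrm{net}(u)=0$ for $u\notin S\cup T$. -}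

module Defs where

open import Data.Bool using (Bool; true; false; _∧_; not; if_then_else_; T)
open import Data.Nat as ℕ using (ℕ; zero; suc; _≡ᵇ_; _<ᵇ_)
open import Data.Fin as Fin using (Fin; toℕ)
open import Data.Vec as Vec using (Vec; []; _∷_; lookup)
open import Data.List as List using (List; []; _∷_; map; allFin; filterᵇ; length; concatMap; foldr)
open import Data.Product using (_×_; _,_)
open import Data.Bool.ListAction using (any; all)
open import Data.Integer using (+_)
open import Data.Rational as ℚ using (ℚ; 0ℚ; _+_; _-_; -_; _*_; _≤_)
open import Relation.Nullary.Decidable using (⌊_⌋)
open import Relation.Binary.PropositionalEquality using (_≡_)

-- Conventions: pegs [p] are represented by Fin p, peg k (1-based) being the
-- element with toℕ = k-1. Disc d_{i+1} is the vector index i : Fin n, so a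
-- larger index means a larger disc; the largest disc d_n is the last entry.
Config : ℕ → ℕ → Set
Config p n = Vec (Fin p) n

allConfigs : ∀ p n → List (Config p n)
allConfigs p zero = [] ∷ []
allConfigs p (suc n) = concatMap (λ x → map (x ∷_) (allConfigs p n)) (allFin p)

_==_ : ∀ {p} → Fin p → Fin p → Bool
x == y = ⌊ x Fin.≟ y ⌋

-- u and v differ by a single legal move of disc d: they agree off d, differ at d,
-- no smaller disc lies on the source peg u[d] (d is a top disc), and no smaller
-- disc lies on the target peg v[d] (all discs there are larger).
legalMoveOf : ∀ {p n} → Config p n → Config p n → Fin n → Bool
legalMoveOf {n = n} u v d =
  all (λ j → (toℕ j ≡ᵇ toℕ d) Data.Bool.∨ (lookup u j == lookup v j)) (allFin n)
  ∧ not (lookup u d == lookup v d)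
  ∧ all (λ j → not (toℕ j <ᵇ toℕ d)
                Data.Bool.∨ (not (lookup u j == lookup u d) ∧ not (lookup u j == lookup v d)))
        (allFin n)
  where import Data.Bool

adj : ∀ {p n} → Config p n → Config p n → Bool
adj {n = n} u v = any (legalMoveOf u v) (allFin n)

largestOn : ∀ {p n} → ℕ → Config p n → Bool
largestOn k [] = false
largestOn k (x ∷ []) = toℕ x ≡ᵇ k
largestOn k (x ∷ xs@(_ ∷ _)) = largestOn k xs

inH1 inH2 : ∀ {p n} → Config p n → Bool
inH1 = largestOn 0
inH2 = largestOn 1

boundary : ∀ p n → (Config p n → Bool) → (Config p n → Bool) → Config p n → Bool
boundary p n A B u = A u ∧ any (λ v → B v ∧ adj u v) (allConfigs p n)

count : ∀ p n → (Config p n → Bool) → ℕ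
count p n P = length (filterᵇ P (allConfigs p n))

-- |∂_e(H_1,H_2)|: edges with one endpoint in H_1 and the other in H_2
-- (H_1, H_2 are disjoint, so each such edge is counted once as (u,v), u∈H_1, v∈H_2)
countCrossEdges : ∀ p n → ℕ
countCrossEdges p n =
  length (filterᵇ (λ uv → inH1 (Data.Product.proj₁ uv) ∧ inH2 (Data.Product.proj₂ uv)
                           ∧ adj (Data.Product.proj₁ uv) (Data.Product.proj₂ uv))
          (List.cartesianProduct (allConfigs p n) (allConfigs p n)))
  where import Data.Product

-- the rational number a / b (b > 0); set to 0 when b = 0 (never used here)
divq : ℕ → ℕ → ℚ
divq a zero = 0ℚ
divq a (suc b) = (+ a) ℚ./ suc b

sumℚ : List ℚ → ℚ
sumℚ = foldr _+_ 0ℚ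

-- a flow on arcs: f u v is the value on the arc (u,v) (only meaningful when adj u v)
Flow : ℕ → ℕ → Set
Flow p n = Config p n → Config p n → ℚ

net : ∀ p n → Flow p n → Config p n → ℚ
net p n f u = sumℚ (map (λ v → if adj u v then f u v - f v u else 0ℚ) (allConfigs p n))

record MSFProblem (p n : ℕ) : Set where
  field
    Src Tgt : Config p n → Bool
    σ δ : Config p n → ℚ

-- Src = S, Tgt = T (renamed to avoid clash with Data.Bool.T)
-- the conservation condition at u, by membership of u in S and T
conservation : ∀ p n → MSFProblem p n → Flow p n → Config p n → Set
conservation p n P f u with MSFProblem.Src P u | MSFProblem.Tgt P u
... | true  | false = net p n f u ≡ MSFProblem.σ P u
... | false | true  = - net p n f u ≡ MSFProblem.δ P u
... | true  | true  = net p n f u ≡ MSFProblem.σ P u - MSFProblem.δ P u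
... | false | false = net p n f u ≡ 0ℚ

Solves : ∀ p n → MSFProblem p n → Flow p n → Set
Solves p n P f =
  (∀ u v → T (adj u v) → 0ℚ ≤ f u v) × (∀ u → conservation p n P f u)

πtran : ∀ p n → MSFProblem p n
πtran p n = record
  { Src = boundary p n inH1 inH2
  ; Tgt = boundary p n inH2 inH1
  ; σ = λ _ → divq (count p n inH1) (count p n (boundary p n inH1 inH2))
  ; δ = λ _ → divq (count p n inH1) (count p n (boundary p n inH1 inH2))
  }

totalFlow : ∀ p n → (Config p n → Flow p n) → Flow p n
totalFlow p n f u v = sumℚ (map (λ s → f s u v) (filterᵇ inH1 (allConfigs p n)))

congestionAtMost : ∀ p n → Flow p n → ℚ → Set
congestionAtMost p n g c =
  ∀ u v → T (adj u v) → divq 1 (length (allConfigs p n)) * g u v ≤ c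

{-# OPTIONS --safe #-}
module Submission where

-- Every source s uses the same flow: σ = |V(H₁)| / |∂ᵥ(H₁,H₂)| on each arc from H₁ to H₂, and
-- nothing elsewhere. An edge between the two copies must move the largest disc, all smaller
-- discs staying put, so a vertex of one copy has at most one neighbour in the other. Hence the
-- crossing edges match ∂ᵥ(H₁,H₂) with ∂ᵥ(H₂,H₁), every boundary vertex has net flow exactly ±σ,
-- and |∂ₑ(H₁,H₂)| = |∂ᵥ(H₁,H₂)|. Summing over the |V(H₁)| sources puts |V(H₁)|² / |∂ᵥ(H₁,H₂)|
-- on each crossing arc, which is the bound since |V(H₁)| = |V(H₂)| = pⁿ⁻¹.

open import Defs

open import Algebra.Bundles using (CommutativeMonoid)
open import Algebra.Definitions using (Identity)
open import Data.Bool using (Bool; true; false; T; not; _∧_; _∨_; if_then_else_)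
open import Data.Bool.ListAction using (any; all)
import Data.Bool.Properties as Bool
open import Algebra.Properties.CommutativeSemigroup (CommutativeMonoid.commutativeSemigroup Bool.∧-commutativeMonoid)
  using (x∙yz≈y∙xz)
open import Data.Empty using (⊥; ⊥-elim)
open import Data.Fin as Fin using (Fin; toℕ; fromℕ)
import Data.Fin.Properties as Fin
import Data.Integer as ℤ
import Data.Integer.Properties as ℤ
open import Data.Integer.Tactic.RingSolver using (solve-∀)
open import Data.List using (List; []; _∷_; map; allFin; foldr; filterᵇ; length; concatMap; cartesianProduct; _++_)
import Data.List.Properties as List
open import Data.List.Membership.Propositional using (lose; find)
open import Data.List.Membership.Propositional.Properties using (∈-allFin; ∈-map⁻)
open import Data.List.Relation.Binary.Disjoint.Propositional using (Disjoint)
open import Data.List.Relation.Unary.All as All using (All; []; _∷_)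
open import Data.List.Relation.Unary.All.Properties using (all⁺; all⁻) renaming (map⁺ to All-map⁺)
import Data.List.Relation.Unary.AllPairs as AllPairs
import Data.List.Relation.Unary.AllPairs.Properties as AllPairs
open import Data.List.Relation.Unary.Any as Any using ()
open import Data.List.Relation.Unary.Any.Properties using (any⁺; any⁻)
open import Data.List.Relation.Unary.Unique.Propositional using (Unique; []; _∷_)
import Data.List.Relation.Unary.Unique.Propositional.Properties as Unique
open import Data.Nat as ℕ using (ℕ; zero; suc; _≡ᵇ_; _<ᵇ_; _+_; _*_; _^_; _<_; _≤_; s≤s; z≤n)
import Data.Nat.Properties as ℕ
open import Data.Nat.ListAction using (sum)
open import Data.Nat.ListAction.Properties using (sum-++)
open import Data.Product using (Σ; ∃; _×_; _,_; proj₁; proj₂; swap)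
open import Data.Product.Function.NonDependent.Propositional using (_×-⇔_)
open import Data.Rational as ℚ using (ℚ; 0ℚ; toℚᵘ)
import Data.Rational.Properties as ℚ
open import Data.Rational.Solver using (module +-*-Solver)
open import Data.Rational.Unnormalised as ℚᵘ using (mkℚᵘ; *≡*)
import Data.Rational.Unnormalised.Properties as ℚᵘ
open import Data.Unit using (tt)
open import Data.Vec using (Vec; []; _∷_; lookup)
import Data.Vec.Properties as Vec
open import Data.Vec.Relation.Binary.Pointwise.Extensional using (ext; Pointwise-≡⇒≡)
open import Function using (_∘_; id)
open import Function.Bundles using (_⇔_; mk⇔; Equivalence)
open import Function.Properties.Equivalence using () renaming (refl to ⇔-refl; trans to ⇔-trans)
open import Function.Related.TypeIsomorphisms using (→-cong-⇔; ¬-cong-⇔)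
open import Relation.Binary.PropositionalEquality
open import Relation.Nullary using (¬_; yes; no)
open import Relation.Nullary.Decidable using (toWitness; fromWitness; decidable-stable)

open Equivalence using (to; from)

T-not : ∀ {b} → T (not b) ⇔ (¬ T b)
T-not {true}  = mk⇔ (λ ()) (λ ¬t → ¬t tt)
T-not {false} = mk⇔ (λ _ ()) (λ _ → tt)

T-∨-¬ : ∀ {a b} → T (a ∨ b) ⇔ (¬ T a → T b)
T-∨-¬ {true}  = mk⇔ (λ _ ¬t → ⊥-elim (¬t tt)) (λ _ → tt)
T-∨-¬ {false} = mk⇔ (λ b _ → b) (λ f → f (λ ()))

T-not-∨ : ∀ {a b} → T (not a ∨ b) ⇔ (T a → T b)
T-not-∨ {true}  = mk⇔ (λ b _ → b) (λ f → f tt)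
T-not-∨ {false} = mk⇔ (λ _ ()) (λ _ → tt)

T-injective : ∀ {a b} → (T a ⇔ T b) → a ≡ b
T-injective {true}  {true}  _   = refl
T-injective {true}  {false} a⇔b = ⊥-elim (to a⇔b tt)
T-injective {false} {true}  a⇔b = ⊥-elim (from a⇔b tt)
T-injective {false} {false} _   = refl

T-== : ∀ {p} {x y : Fin p} → T (x == y) ⇔ x ≡ y
T-== = mk⇔ toWitness fromWitness

T-≡ᵇ-toℕ : ∀ {n} {i j : Fin n} → T (toℕ i ≡ᵇ toℕ j) ⇔ i ≡ j
T-≡ᵇ-toℕ = mk⇔ (λ h → Fin.toℕ-injective (ℕ.≡ᵇ⇒≡ _ _ h))
                (λ i≡j → ℕ.≡⇒≡ᵇ _ _ (cong toℕ i≡j))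

T-<ᵇ : ∀ {m n} → T (m <ᵇ n) ⇔ m ℕ.< n
T-<ᵇ = mk⇔ (ℕ.<ᵇ⇒< _ _) ℕ.<⇒<ᵇ

T-all-allFin : ∀ {n} (P : Fin n → Bool) → T (all P (allFin n)) ⇔ (∀ j → T (P j))
T-all-allFin P = mk⇔ (λ h j → All.lookup (all⁺ P (allFin _) h) (∈-allFin j))
                     (λ h → all⁻ P {allFin _} (All.tabulate (λ {j} _ → h j)))

T-any-allFin : ∀ {n} (P : Fin n → Bool) → T (any P (allFin n)) ⇔ ∃ (T ∘ P)
T-any-allFin P = mk⇔ (Any.satisfied ∘ any⁻ P (allFin _))
                     (λ (j , pj) → any⁺ P (lose {xs = allFin _} (∈-allFin j) pj))

T-≢ : ∀ {p} {x y : Fin p} → T (not (x == y)) ⇔ x ≢ y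
T-≢ = ⇔-trans T-not (¬-cong-⇔ T-==)

-- Legal moves

record LegalMove {p n} (u v : Config p n) (d : Fin n) : Set where
  field
    others-stay   : ∀ j → j ≢ d → lookup u j ≡ lookup v j
    disc-moves    : lookup u d ≢ lookup v d
    smaller-clear : ∀ j → j Fin.< d → lookup u j ≢ lookup u d × lookup u j ≢ lookup v d

module _ {p n} {u v : Config p n} {d : Fin n} where

  private
    Stays Clear : Fin n → Bool
    Stays j = (toℕ j ≡ᵇ toℕ d) ∨ (lookup u j == lookup v j)
    Clear j = not (toℕ j <ᵇ toℕ d) ∨ (not (lookup u j == lookup u d) ∧ not (lookup u j == lookup v d))

    stay⇔ : ∀ {j} → T (Stays j) ⇔ (j ≢ d → lookup u j ≡ lookup v j)
    stay⇔ = ⇔-trans T-∨-¬ (→-cong-⇔ (¬-cong-⇔ T-≡ᵇ-toℕ) T-==)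

    clear⇔ : ∀ {j} → T (Clear j) ⇔ (j Fin.< d → lookup u j ≢ lookup u d × lookup u j ≢ lookup v d)
    clear⇔ = ⇔-trans T-not-∨ (→-cong-⇔ T-<ᵇ (⇔-trans Bool.T-∧ (T-≢ ×-⇔ T-≢)))

  legalMoveOf⇒LegalMove : T (legalMoveOf u v d) → LegalMove u v d
  legalMoveOf⇒LegalMove h =
    let stays , rest   = to (Bool.T-∧ {all Stays (allFin n)}) h
        moves , clears = to Bool.T-∧ rest
    in record
      { others-stay   = λ j → to stay⇔ (to (T-all-allFin Stays) stays j)
      ; disc-moves    = to T-≢ moves
      ; smaller-clear = λ j → to clear⇔ (to (T-all-allFin Clear) clears j)
      }

  LegalMove⇒legalMoveOf : LegalMove u v d → T (legalMoveOf u v d)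
  LegalMove⇒legalMoveOf m = from Bool.T-∧
    ( from (T-all-allFin Stays) (λ j → from stay⇔ (others-stay j))
    , from Bool.T-∧ (from T-≢ disc-moves , from (T-all-allFin Clear) (λ j → from clear⇔ (smaller-clear j))))
    where open LegalMove m

LegalMove-sym : ∀ {p n} {u v : Config p n} {d} → LegalMove u v d → LegalMove v u d
LegalMove-sym {u = u} {v} {d} m = record
  { others-stay   = λ j j≢d → sym (others-stay j j≢d)
  ; disc-moves    = disc-moves ∘ sym
  ; smaller-clear = λ j j<d → subst (λ x → x ≢ lookup v d × x ≢ lookup u d)
                                    (others-stay j (λ { refl → ℕ.<-irrefl refl j<d }))
                                    (swap (smaller-clear j j<d))
  }
  where open LegalMove m

adj⇒LegalMove : ∀ {p n} {u v : Config p n} → T (adj u v) → ∃ (LegalMove u v)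
adj⇒LegalMove {u = u} {v} h = let d , m = to (T-any-allFin (legalMoveOf u v)) h in d , legalMoveOf⇒LegalMove m

LegalMove⇒adj : ∀ {p n} {u v : Config p n} {d} → LegalMove u v d → T (adj u v)
LegalMove⇒adj {u = u} {v} m = from (T-any-allFin (legalMoveOf u v)) (_ , LegalMove⇒legalMoveOf m)

adj-sym : ∀ {p n} (u v : Config p n) → adj u v ≡ adj v u
adj-sym u v = T-injective (mk⇔ (flip u v) (flip v u))
  where
  flip : ∀ x y → T (adj x y) → T (adj y x)
  flip x y h = LegalMove⇒adj (LegalMove-sym (proj₂ (adj⇒LegalMove {u = x} {y} h)))

AtMostOne : ∀ {A : Set} → (A → Bool) → Set
AtMostOne Q = ∀ {x y} → T (Q x) → T (Q y) → x ≡ y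

if-¬T : ∀ {A : Set} {b} {x y : A} → ¬ T b → (if b then x else y) ≡ y
if-¬T {b = true}  ¬b = ⊥-elim (¬b tt)
if-¬T {b = false} _  = refl

any-∧ˡ : ∀ {A : Set} b (P : A → Bool) xs → any (λ x → b ∧ P x) xs ≡ b ∧ any P xs
any-∧ˡ true  P xs       = refl
any-∧ˡ false P []       = refl
any-∧ˡ false P (_ ∷ xs) = any-∧ˡ false P xs

atMostOne⇒¬any : ∀ {A : Set} {Q : A → Bool} {x xs} →
  AtMostOne Q → T (Q x) → All (x ≢_) xs → ¬ T (any Q xs)
atMostOne⇒¬any {Q = Q} {xs = xs} Q! qx x∉xs h =
  let y , y∈xs , qy = find (any⁻ Q xs h) in All.lookup x∉xs y∈xs (Q! qx qy)

module _ {A C : Set} {_∙_ : C → C → C} {ε : C} (identity : Identity _≡_ ε _∙_) where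

  foldr-indicator : ∀ {Q : A → Bool} {xs} (c : C) → Unique xs → AtMostOne Q →
    foldr _∙_ ε (map (λ x → if Q x then c else ε) xs) ≡ (if any Q xs then c else ε)
  foldr-indicator c [] _ = refl
  foldr-indicator {Q} {x ∷ xs} c (x∉xs ∷ !xs) Q! with Q x in qx
  ... | true  = trans (cong (c ∙_) (trans (foldr-indicator c !xs Q!) (if-¬T none-after-x))) (proj₂ identity c)
    where none-after-x = atMostOne⇒¬any Q! (from Bool.T-≡ qx) x∉xs
  ... | false = trans (proj₁ identity _) (foldr-indicator c !xs Q!)

length-filterᵇ : ∀ {A : Set} (P : A → Bool) xs →
  length (filterᵇ P xs) ≡ sum (map (λ x → if P x then 1 else 0) xs)
length-filterᵇ P [] = refl
length-filterᵇ P (x ∷ xs) with P x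
... | true  = cong suc (length-filterᵇ P xs)
... | false = length-filterᵇ P xs

sum-concatMap-map : ∀ {A B C : Set} (g : C → ℕ) (f : A → B → C) xs ys →
  sum (map g (concatMap (λ x → map (f x) ys) xs)) ≡ sum (map (λ x → sum (map (λ y → g (f x y)) ys)) xs)
sum-concatMap-map g f []       ys = refl
sum-concatMap-map g f (x ∷ xs) ys = begin
  sum (map g (map (f x) ys ++ concatMap (λ x → map (f x) ys) xs))
    ≡⟨ cong sum (List.map-++ g (map (f x) ys) _) ⟩
  sum (map g (map (f x) ys) ++ map g (concatMap (λ x → map (f x) ys) xs))
    ≡⟨ sum-++ (map g (map (f x) ys)) _ ⟩
  sum (map g (map (f x) ys)) + sum (map g (concatMap (λ x → map (f x) ys) xs))
    ≡⟨ cong₂ _+_ (cong sum (sym (List.map-∘ ys))) (sum-concatMap-map g f xs ys) ⟩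
  sum (map (λ y → g (f x y)) ys) + sum (map (λ x → sum (map (λ y → g (f x y)) ys)) xs) ∎
  where open ≡-Reasoning

cartesianProduct≡concatMap : ∀ {A B : Set} (xs : List A) (ys : List B) →
  cartesianProduct xs ys ≡ concatMap (λ x → map (x ,_) ys) xs
cartesianProduct≡concatMap []       ys = refl
cartesianProduct≡concatMap (x ∷ xs) ys = cong (map (x ,_) ys ++_) (cartesianProduct≡concatMap xs ys)

sum-map-const : ∀ {A : Set} (xs : List A) m → sum (map (λ _ → m) xs) ≡ length xs * m
sum-map-const []       m = refl
sum-map-const (_ ∷ xs) m = cong (m +_) (sum-map-const xs m)

lookup-split-ext : ∀ {A : Set} {n} {v w : Vec A n} (i : Fin n) →
  (∀ j → j ≢ i → lookup v j ≡ lookup w j) → lookup v i ≡ lookup w i → v ≡ w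
lookup-split-ext {v = v} {w} i off at = Pointwise-≡⇒≡ (ext agree)
  where
  agree : ∀ j → lookup v j ≡ lookup w j
  agree j with j Fin.≟ i
  ... | yes refl = at
  ... | no j≢i   = off j j≢i

-- Edges between the copies of H_p^(n-1)

largestOn-peg : ∀ {p k c} (u : Config p (suc k)) → T (largestOn c u) → toℕ (lookup u (fromℕ k)) ≡ c
largestOn-peg {k = zero}  (x ∷ [])     h = ℕ.≡ᵇ⇒≡ _ _ h
largestOn-peg {k = suc k} (x ∷ y ∷ ys) h = largestOn-peg (y ∷ ys) h

largestOn-∷ : ∀ {p k c} x (u : Config p (suc k)) → largestOn c (x ∷ u) ≡ largestOn c u
largestOn-∷ x (_ ∷ _) = refl

crossEdge : ∀ {p n} → ℕ → ℕ → Config p n → Config p n → Bool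
crossEdge a b u v = largestOn a u ∧ largestOn b v ∧ adj u v

T-crossEdge : ∀ {p n} a b (u v : Config p n) →
  T (crossEdge a b u v) ⇔ (T (largestOn a u) × T (largestOn b v) × T (adj u v))
T-crossEdge a b u v = ⇔-trans Bool.T-∧ (⇔-refl ×-⇔ Bool.T-∧)

module _ {p k a b : ℕ} (a≢b : a ≢ b) where

  across-only-largest-moves : (u v : Config p (suc k)) →
    T (largestOn a u) → T (largestOn b v) → T (adj u v) → ∀ j → j ≢ fromℕ k → lookup u j ≡ lookup v j
  across-only-largest-moves u v hu hv u~v j j≢L =
    let d , m = adj⇒LegalMove {u = u} {v} u~v
        open LegalMove m
        largest-moves : fromℕ k ≢ d → ⊥
        largest-moves L≢d = a≢b (begin
          a                             ≡⟨ sym (largestOn-peg u hu) ⟩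
          toℕ (lookup u (fromℕ k))      ≡⟨ cong toℕ (others-stay (fromℕ k) L≢d) ⟩
          toℕ (lookup v (fromℕ k))      ≡⟨ largestOn-peg v hv ⟩
          b                             ∎)
        d≡L = sym (decidable-stable (fromℕ k Fin.≟ d) largest-moves)
    in others-stay j (λ j≡d → j≢L (trans j≡d d≡L))
    where open ≡-Reasoning

  crossEdge-atMostOne : (u : Config p (suc k)) → AtMostOne (crossEdge a b u)
  crossEdge-atMostOne u {v} {w} huv huw =
    let hu , hv , u~v = to (T-crossEdge a b u v) huv
        _  , hw , u~w = to (T-crossEdge a b u w) huw
    in lookup-split-ext (fromℕ k)
         (λ j j≢L → trans (sym (across-only-largest-moves u v hu hv u~v j j≢L))
                          (across-only-largest-moves u w hu hw u~w j j≢L))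
         (Fin.toℕ-injective (trans (largestOn-peg v hv) (sym (largestOn-peg w hw))))

crossEdge-swap : ∀ {p n a b} (u v : Config p n) → crossEdge a b v u ≡ crossEdge b a u v
crossEdge-swap {a = a} {b} u v = trans (cong (λ e → largestOn a v ∧ (largestOn b u ∧ e)) (adj-sym v u))
                                       (x∙yz≈y∙xz (largestOn a v) (largestOn b u) (adj u v))

-- Counting configurations

allConfigs-unique : ∀ p n → Unique (allConfigs p n)
allConfigs-unique p zero    = [] ∷ []
allConfigs-unique p (suc n) = Unique.concat⁺
  (All-map⁺ (All.universal (λ x → Unique.map⁺ Vec.∷-injectiveʳ (allConfigs-unique p n)) (allFin p)))
  (AllPairs.map⁺ (AllPairs.map blocks-disjoint (Unique.allFin⁺ p)))
  where
  blocks-disjoint : ∀ {x y} → x ≢ y → Disjoint (map (x ∷_) (allConfigs p n)) (map (y ∷_) (allConfigs p n))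
  blocks-disjoint x≢y (v∈x , v∈y) =
    let _ , _ , v≡x∷ = ∈-map⁻ (_ ∷_) v∈x
        _ , _ , v≡y∷ = ∈-map⁻ (_ ∷_) v∈y
    in x≢y (Vec.∷-injectiveˡ (trans (sym v≡x∷) v≡y∷))

module _ {p k a b : ℕ} (a≢b : a ≢ b)
         {C : Set} {_∙_ : C → C → C} {ε : C} (identity : Identity _≡_ ε _∙_) where

  foldr-crossEdge : ∀ (u : Config p (suc k)) c →
    foldr _∙_ ε (map (λ v → if crossEdge a b u v then c else ε) (allConfigs p (suc k)))
      ≡ (if boundary p (suc k) (largestOn a) (largestOn b) u then c else ε)
  foldr-crossEdge u c =
    trans (foldr-indicator identity c (allConfigs-unique p (suc k)) (crossEdge-atMostOne a≢b u))
          (cong (λ t → if t then c else ε) (any-∧ˡ (largestOn a u) _ (allConfigs p (suc k))))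

countCrossEdges≡count-boundary : ∀ p k →
  countCrossEdges p (suc k) ≡ count p (suc k) (boundary p (suc k) inH1 inH2)
countCrossEdges≡count-boundary p k = begin
  length (filterᵇ R (cartesianProduct AC AC))
    ≡⟨ length-filterᵇ R (cartesianProduct AC AC) ⟩
  sum (map (λ uv → if R uv then 1 else 0) (cartesianProduct AC AC))
    ≡⟨ cong (sum ∘ map _) (cartesianProduct≡concatMap AC AC) ⟩
  sum (map (λ uv → if R uv then 1 else 0) (concatMap (λ u → map (u ,_) AC) AC))
    ≡⟨ sum-concatMap-map (λ uv → if R uv then 1 else 0) _,_ AC AC ⟩
  sum (map (λ u → sum (map (λ v → if crossEdge 0 1 u v then 1 else 0) AC)) AC)
    ≡⟨ cong sum (List.map-cong (λ u → foldr-crossEdge (λ ()) ℕ.+-identity u 1) AC) ⟩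
  sum (map (λ u → if boundary p (suc k) inH1 inH2 u then 1 else 0) AC)
    ≡⟨ sym (length-filterᵇ _ AC) ⟩
  count p (suc k) (boundary p (suc k) inH1 inH2) ∎
  where
  open ≡-Reasoning
  AC = allConfigs p (suc k)
  R : Config p (suc k) × Config p (suc k) → Bool
  R (u , v) = crossEdge 0 1 u v

count-largestOn : ∀ {p c} → c < p → ∀ k → count p (suc k) (largestOn c) ≡ p ^ k
count-largestOn {p} {c} c<p k = trans (length-filterᵇ _ (allConfigs p (suc k))) (on-largest k)
  where
  open ≡-Reasoning
  on-peg-c : Fin p → Bool
  on-peg-c x = toℕ x ≡ᵇ c

  on-largest : ∀ k → sum (map (λ u → if largestOn c u then 1 else 0) (allConfigs p (suc k))) ≡ p ^ k
  on-largest zero = begin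
    sum (map (λ u → if largestOn c u then 1 else 0) (allConfigs p 1))
      ≡⟨ sum-concatMap-map (λ u → if largestOn c u then 1 else 0) _∷_ (allFin p) ([] ∷ []) ⟩
    sum (map (λ x → (if on-peg-c x then 1 else 0) + 0) (allFin p))
      ≡⟨ cong sum (List.map-cong (λ x → ℕ.+-identityʳ _) (allFin p)) ⟩
    sum (map (λ x → if on-peg-c x then 1 else 0) (allFin p))
      ≡⟨ foldr-indicator ℕ.+-identity 1 (Unique.allFin⁺ p) on-peg-c-atMostOne ⟩
    (if any on-peg-c (allFin p) then 1 else 0)
      ≡⟨ cong (λ t → if t then 1 else 0) (to Bool.T-≡ (from (T-any-allFin on-peg-c) some-on-peg-c)) ⟩
    1 ∎
    where
    on-peg-c-atMostOne : AtMostOne on-peg-c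
    on-peg-c-atMostOne hx hy = Fin.toℕ-injective (trans (ℕ.≡ᵇ⇒≡ _ _ hx) (sym (ℕ.≡ᵇ⇒≡ _ _ hy)))
    some-on-peg-c : ∃ (T ∘ on-peg-c)
    some-on-peg-c = Fin.fromℕ< c<p , ℕ.≡⇒≡ᵇ _ _ (Fin.toℕ-fromℕ< c<p)
  on-largest (suc k) = begin
    sum (map (λ u → if largestOn c u then 1 else 0) (allConfigs p (suc (suc k))))
      ≡⟨ sum-concatMap-map (λ u → if largestOn c u then 1 else 0) _∷_ (allFin p) (allConfigs p (suc k)) ⟩
    sum (map (λ x → sum (map (λ u → if largestOn c (x ∷ u) then 1 else 0) (allConfigs p (suc k)))) (allFin p))
      ≡⟨ cong sum (List.map-cong (λ x → trans (drop-head x) (on-largest k)) (allFin p)) ⟩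
    sum (map (λ _ → p ^ k) (allFin p))
      ≡⟨ sum-map-const (allFin p) (p ^ k) ⟩
    length (allFin p) * p ^ k
      ≡⟨ cong (_* p ^ k) (List.length-tabulate {n = p} id) ⟩
    p * p ^ k ∎
    where
    drop-head : ∀ x → sum (map (λ u → if largestOn c (x ∷ u) then 1 else 0) (allConfigs p (suc k)))
                    ≡ sum (map (λ u → if largestOn c u then 1 else 0) (allConfigs p (suc k)))
    drop-head x = cong sum (List.map-cong (cong (λ t → if t then 1 else 0) ∘ largestOn-∷ x) (allConfigs p (suc k)))

count-inH2≡count-inH1 : ∀ {p} k → 1 < p → count p (suc k) inH2 ≡ count p (suc k) inH1
count-inH2≡count-inH1 k 1<p =
  trans (count-largestOn 1<p k) (sym (count-largestOn (ℕ.<-trans (s≤s z≤n) 1<p) k))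

toℚᵘ-divq : ∀ a b → toℚᵘ (divq a (suc b)) ℚᵘ.≃ mkℚᵘ (ℤ.+ a) b
toℚᵘ-divq a b = ℚ.toℚᵘ-fromℚᵘ (mkℚᵘ (ℤ.+ a) b)

divq-nonneg : ∀ a b → 0ℚ ℚ.≤ divq a b
divq-nonneg a zero    = ℚ.≤-refl
divq-nonneg a (suc b) = ℚ.nonNegative⁻¹ _ {{ℚ.normalize-nonNeg a (suc b)}}

divq-zero : ∀ b → divq 0 b ≡ 0ℚ
divq-zero zero    = refl
divq-zero (suc b) = ℚ.toℚᵘ-injective (ℚᵘ.≃-trans (toℚᵘ-divq 0 b) (*≡* refl))

divq-+ : ∀ a c b → divq a b ℚ.+ divq c b ≡ divq (a + c) b
divq-+ a c zero    = refl
divq-+ a c (suc b) = ℚ.toℚᵘ-injective (begin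
  toℚᵘ (divq a (suc b) ℚ.+ divq c (suc b))
    ≈⟨ ℚ.toℚᵘ-homo-+ (divq a (suc b)) (divq c (suc b)) ⟩
  toℚᵘ (divq a (suc b)) ℚᵘ.+ toℚᵘ (divq c (suc b))
    ≈⟨ ℚᵘ.+-cong (toℚᵘ-divq a b) (toℚᵘ-divq c b) ⟩
  mkℚᵘ (ℤ.+ a) b ℚᵘ.+ mkℚᵘ (ℤ.+ c) b
    ≈⟨ *≡* cross ⟩
  mkℚᵘ (ℤ.+ (a + c)) b
    ≈⟨ ℚᵘ.≃-sym (toℚᵘ-divq (a + c) b) ⟩
  toℚᵘ (divq (a + c) (suc b)) ∎)
  where
  open ℚᵘ.≃-Reasoning
  distrib : ∀ x y z → (x ℤ.* z ℤ.+ y ℤ.* z) ℤ.* z ≡ (x ℤ.+ y) ℤ.* (z ℤ.* z)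
  distrib = solve-∀
  cross : (ℤ.+ a ℤ.* ℤ.+ suc b ℤ.+ ℤ.+ c ℤ.* ℤ.+ suc b) ℤ.* ℤ.+ suc b
        ≡ ℤ.+ (a + c) ℤ.* ℤ.+ (suc b * suc b)
  cross = trans (distrib (ℤ.+ a) (ℤ.+ c) (ℤ.+ suc b))
                (sym (cong₂ ℤ._*_ (ℤ.pos-+ a c) (ℤ.pos-* (suc b) (suc b))))

divq-* : ∀ a b c d → divq a b ℚ.* divq c d ≡ divq (a * c) (b * d)
divq-* a zero    c d                   = ℚ.*-zeroˡ (divq c d)
divq-* a (suc b) c zero rewrite ℕ.*-zeroʳ b = ℚ.*-zeroʳ (divq a (suc b))
divq-* a (suc b) c (suc d) = ℚ.toℚᵘ-injective (begin
  toℚᵘ (divq a (suc b) ℚ.* divq c (suc d))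
    ≈⟨ ℚ.toℚᵘ-homo-* (divq a (suc b)) (divq c (suc d)) ⟩
  toℚᵘ (divq a (suc b)) ℚᵘ.* toℚᵘ (divq c (suc d))
    ≈⟨ ℚᵘ.*-cong (toℚᵘ-divq a b) (toℚᵘ-divq c d) ⟩
  mkℚᵘ (ℤ.+ a) b ℚᵘ.* mkℚᵘ (ℤ.+ c) d
    ≈⟨ *≡* (cong (ℤ._* ℤ.+ (suc b * suc d)) (sym (ℤ.pos-* a c))) ⟩
  mkℚᵘ (ℤ.+ (a * c)) (d + b * suc d)
    ≈⟨ ℚᵘ.≃-sym (toℚᵘ-divq (a * c) (d + b * suc d)) ⟩
  toℚᵘ (divq (a * c) (suc b * suc d)) ∎)
  where open ℚᵘ.≃-Reasoning

sumℚ-zeros : ∀ {A : Set} (xs : List A) → sumℚ (map (λ _ → 0ℚ) xs) ≡ 0ℚ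
sumℚ-zeros []       = refl
sumℚ-zeros (_ ∷ xs) = cong (0ℚ ℚ.+_) (sumℚ-zeros xs)

sumℚ-map-divq : ∀ {A : Set} (xs : List A) a b → sumℚ (map (λ _ → divq a b) xs) ≡ divq (length xs * a) b
sumℚ-map-divq []       a b = sym (divq-zero b)
sumℚ-map-divq (_ ∷ xs) a b = trans (cong (divq a b ℚ.+_) (sumℚ-map-divq xs a b)) (divq-+ a (length xs * a) b)

sumℚ-map-− : ∀ {A : Set} (f g : A → ℚ) xs →
  sumℚ (map (λ x → f x ℚ.- g x) xs) ≡ sumℚ (map f xs) ℚ.- sumℚ (map g xs)
sumℚ-map-− f g []       = refl
sumℚ-map-− f g (x ∷ xs) =
  trans (cong (f x ℚ.- g x ℚ.+_) (sumℚ-map-− f g xs))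
        (interchange (f x) (g x) (sumℚ (map f xs)) (sumℚ (map g xs)))
  where
  open +-*-Solver
  interchange : ∀ a b s t → (a ℚ.- b) ℚ.+ (s ℚ.- t) ≡ (a ℚ.+ s) ℚ.- (b ℚ.+ t)
  interchange = solve 4 (λ a b s t → (a :- b) :+ (s :- t) := (a :+ s) :- (b :+ t)) refl

-- The transfer flow

prescribedNet : ∀ {p n} → MSFProblem p n → Config p n → ℚ
prescribedNet P u = (if Src u then σ u else 0ℚ) ℚ.- (if Tgt u then δ u else 0ℚ)
  where open MSFProblem P

net≡prescribedNet⇒conservation : ∀ {p n} (P : MSFProblem p n) f u →
  net p n f u ≡ prescribedNet P u → conservation p n P f u
net≡prescribedNet⇒conservation P f u with MSFProblem.Src P u | MSFProblem.Tgt P u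
... | true  | false = λ h → trans h (ℚ.+-identityʳ _)
... | false | true  = λ h → trans (cong ℚ.-_ h) (neg-0- _)
  where
  open +-*-Solver
  neg-0- : ∀ x → ℚ.- (0ℚ ℚ.- x) ≡ x
  neg-0- = solve 1 (λ x → :- (con 0ℚ :- x) := x) refl
... | true  | true  = id
... | false | false = id

net-supported : ∀ {p n} (f : Flow p n) → (∀ u v → ¬ T (adj u v) → f u v ≡ 0ℚ) → ∀ u →
  net p n f u ≡ sumℚ (map (f u) (allConfigs p n)) ℚ.- sumℚ (map (λ v → f v u) (allConfigs p n))
net-supported {p} {n} f supp u =
  trans (cong sumℚ (List.map-cong on-edges (allConfigs p n))) (sumℚ-map-− (f u) (λ v → f v u) (allConfigs p n))
  where
  on-edges : ∀ v → (if adj u v then f u v ℚ.- f v u else 0ℚ) ≡ f u v ℚ.- f v u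
  on-edges v with adj u v in u~v
  ... | true  = refl
  ... | false = sym (cong₂ ℚ._-_ (supp u v (λ h → subst T u~v h))
                                 (supp v u (λ h → subst T (trans (adj-sym v u) u~v) h)))

transferFlow : ∀ {p n} → ℚ → Flow p n
transferFlow σ u v = if crossEdge 0 1 u v then σ else 0ℚ

transferFlow-nonneg : ∀ {p n} {σ} → 0ℚ ℚ.≤ σ →
  ∀ (u v : Config p n) → T (adj u v) → 0ℚ ℚ.≤ transferFlow σ u v
transferFlow-nonneg 0≤σ u v _ with crossEdge 0 1 u v
... | true  = 0≤σ
... | false = ℚ.≤-refl

net-transferFlow : ∀ {p k} σ (u : Config p (suc k)) →
  net p (suc k) (transferFlow σ) u
    ≡ (if boundary p (suc k) inH1 inH2 u then σ else 0ℚ)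
      ℚ.- (if boundary p (suc k) inH2 inH1 u then σ else 0ℚ)
net-transferFlow {p} {k} σ u = begin
  net p (suc k) (transferFlow σ) u
    ≡⟨ net-supported (transferFlow σ) off-edges u ⟩
  sumℚ (map (transferFlow σ u) AC) ℚ.- sumℚ (map (λ v → transferFlow σ v u) AC)
    ≡⟨ cong₂ ℚ._-_ (foldr-crossEdge (λ ()) ℚ.+-identity u σ)
                   (trans (cong sumℚ (List.map-cong reverse-arc AC)) (foldr-crossEdge (λ ()) ℚ.+-identity u σ)) ⟩
  (if boundary p (suc k) inH1 inH2 u then σ else 0ℚ)
    ℚ.- (if boundary p (suc k) inH2 inH1 u then σ else 0ℚ) ∎
  where
  open ≡-Reasoning
  AC = allConfigs p (suc k)
  off-edges : ∀ u v → ¬ T (adj u v) → transferFlow σ u v ≡ 0ℚ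
  off-edges u v ¬u~v = if-¬T (λ h → ¬u~v (proj₂ (proj₂ (to (T-crossEdge 0 1 u v) h))))
  reverse-arc : ∀ v → transferFlow σ v u ≡ (if crossEdge 1 0 u v then σ else 0ℚ)
  reverse-arc v = cong (λ t → if t then σ else 0ℚ) (crossEdge-swap u v)

replicated-congestion : ∀ {A : Set} (xs : List A) b V (c : Bool) →
  divq 1 V ℚ.* sumℚ (map (λ _ → if c then divq (length xs) b else 0ℚ) xs)
    ℚ.≤ divq (length xs * length xs) (b * V)
replicated-congestion xs b V true = ℚ.≤-reflexive (begin
  divq 1 V ℚ.* sumℚ (map (λ _ → divq (length xs) b) xs)
    ≡⟨ cong (divq 1 V ℚ.*_) (sumℚ-map-divq xs (length xs) b) ⟩
  divq 1 V ℚ.* divq (length xs * length xs) b           ≡⟨ divq-* 1 V _ b ⟩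
  divq (1 * (length xs * length xs)) (V * b)            ≡⟨ cong₂ divq (ℕ.*-identityˡ _) (ℕ.*-comm V b) ⟩
  divq (length xs * length xs) (b * V)                  ∎)
  where open ≡-Reasoning
replicated-congestion xs b V false rewrite sumℚ-zeros xs | ℚ.*-zeroʳ (divq 1 V) =
  divq-nonneg (length xs * length xs) (b * V)

lemma9 : (p n : ℕ) → 3 ≤ p → 2 ≤ n →
    Σ (Config p n → Flow p n) (λ f →
      ((s : Config p n) → T (inH1 s) → Solves p n (πtran p n) (f s))
      × congestionAtMost p n (totalFlow p n f)
          (divq (count p n inH1 * count p n inH2)
                (countCrossEdges p n * length (allConfigs p n))))
lemma9 p n@(suc k) (s≤s (s≤s (s≤s _))) (s≤s (s≤s _)) =
  (λ _ → transferFlow σ) , (λ _ _ → solves) , congestion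
  where
  h = count p n inH1
  B = count p n (boundary p n inH1 inH2)
  V = length (allConfigs p n)
  σ = divq h B

  solves : Solves p n (πtran p n) (transferFlow σ)
  solves = transferFlow-nonneg (divq-nonneg h B)
         , λ u → net≡prescribedNet⇒conservation (πtran p n) _ u (net-transferFlow σ u)

  same-bound : divq (h * h) (B * V) ≡ divq (h * count p n inH2) (countCrossEdges p n * V)
  same-bound = cong₂ divq (cong (h *_) (sym (count-inH2≡count-inH1 k (s≤s (s≤s z≤n)))))
                          (cong (_* V) (sym (countCrossEdges≡count-boundary p k)))

  congestion : congestionAtMost p n (totalFlow p n (λ _ → transferFlow σ))
                 (divq (h * count p n inH2) (countCrossEdges p n * V))
  -- The flow does not depend on the source, so its total on an arc is |V(H₁)| copies of one value.
  congestion u v _ = subst (divq 1 V ℚ.* totalFlow p n (λ _ → transferFlow σ) u v ℚ.≤_) same-bound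
                           (replicated-congestion (filterᵇ inH1 (allConfigs p n)) B V (crossEdge 0 1 u v))
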